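{- Let $\mathbf{A}$ be a BL-algebra, $\mathbf{B}$ a BL-subalgebra of $\mathbf{A}$ and $c\in A$ such that $(B,c)$ is a $c$-relatively complete subalgebra. Define on $A$ the operations $\forall a:=\max\{b\in B: b\le c\to a\}$ and $\exists a:=\min\{b\in B: c\ast a\le b\}$. Then $\langle\mathbf{A},\forall,\exists\rangle$ is a c-EBL-algebra with focal element $c$, and $\forall A=\exists A=B$. Conversely, if $\langle\mathbf{A},\forall,\exists\rangle$ is a c-EBL-algebra with focal element $c$, then $(\forall A,c)$ is a $c$-relatively complete subalgebra of $\mathbf{A}$.
   Context: A BL-algebra is an algebra $\langle A,\wedge,\vee,\ast,\to,0,1\rangle$ such that $\langle A,\wedge,\vee,0,1\rangle$ is a bounded lattice (order $\le$), $\langle A,\ast,1\rangle$ is a commutative monoid, $a\ast b\le c$ iff $a\le b\to c$, and $a\wedge b=a\ast(a\to b)$ and $(a\to b)\vee(b\to a)=1$ hold; $c^2:=c\ast c$. An Epistemic BL-algebra (EBL-algebra) is a BL-algebra with unary operations $\forall,\exists$ satisfying, for all $a,b$: $\forall 1=1$; $\exists 0=0$; $\forall a\to\exists a=1$; $\forall(a\to\forall b)=\exists a\to\forall b$; $\forall(\forall a\to b)=\forall a\to\forall b$; $\exists a\to\forall\exists a=1$; $\forall(a\wedge b)=\forall a\wedge\forall b$; $\exists(a\vee b)=\exists a\vee\exists b$; $\exists(a\ast\exists b)=\exists a\ast\exists b$. If $\{a\in A:\forall a=1\}$ has a least element $c$, it is called the focal element, and the EBL-algebra is then called a c-EBL-algebra.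 For a BL-algebra $\mathbf{A}$, a subalgebra $\mathbf{B}$ and $c\in A$, the pair $(B,c)$ is a $c$-relatively complete subalgebra if (e1) for every $a\in A$ the set $\{b\in B: b\le c\to a\}$ has a greatest element and the set $\{b\in B: c\ast a\le b\}$ has a least element; and (e2) $\{a\in A: c^2\le a\}\cap B=\{1\}$. Here $\forall A=\{\forall a:a\in A\}$, $\exists A=\{\exists a: a\in A\}$. -}

module Defs where

open import Data.Product using (Σ; _×_; _,_; proj₁; ∃)
open import Relation.Binary.PropositionalEquality using (_≡_)

infixr 6 _⇔_
_⇔_ : Set → Set → Set
P ⇔ Q = (P → Q) × (Q → P)

record BLAlgebra : Set₁ where
  infixr 5 _⇒_
  infixl 7 _∗_
  infixl 6 _⊓_
  infixl 5 _⊔_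
  infix 4 _≤_
  field
    Carrier : Set
    _⊓_ _⊔_ _∗_ _⇒_ : Carrier → Carrier → Carrier
    𝟘 𝟙 : Carrier
    ⊓-comm   : ∀ a b → a ⊓ b ≡ b ⊓ a
    ⊔-comm   : ∀ a b → a ⊔ b ≡ b ⊔ a
    ⊓-assoc  : ∀ a b c → (a ⊓ b) ⊓ c ≡ a ⊓ (b ⊓ c)
    ⊔-assoc  : ∀ a b c → (a ⊔ b) ⊔ c ≡ a ⊔ (b ⊔ c)
    ⊓-absorb : ∀ a b → a ⊓ (a ⊔ b) ≡ a
    ⊔-absorb : ∀ a b → a ⊔ (a ⊓ b) ≡ a
  _≤_ : Carrier → Carrier → Set
  a ≤ b = a ⊓ b ≡ a
  field
    𝟘-least    : ∀ a → 𝟘 ≤ a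
    𝟙-greatest : ∀ a → a ≤ 𝟙
    ∗-comm     : ∀ a b → a ∗ b ≡ b ∗ a
    ∗-assoc    : ∀ a b c → (a ∗ b) ∗ c ≡ a ∗ (b ∗ c)
    ∗-identity : ∀ a → a ∗ 𝟙 ≡ a
    residuation : ∀ a b c → (a ∗ b ≤ c) ⇔ (a ≤ b ⇒ c)
    divisibility : ∀ a b → a ⊓ b ≡ a ∗ (a ⇒ b)
    prelinearity : ∀ a b → (a ⇒ b) ⊔ (b ⇒ a) ≡ 𝟙

  _² : Carrier → Carrier
  c ² = c ∗ c

module _ (A : BLAlgebra) where
  open BLAlgebra A

  record IsSubalgebra (B : Carrier → Set) : Set where
    field
      𝟘∈ : B 𝟘
      𝟙∈ : B 𝟙
      ⊓∈ : ∀ {a b} → B a → B b → B (a ⊓ b)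
      ⊔∈ : ∀ {a b} → B a → B b → B (a ⊔ b)
      ∗∈ : ∀ {a b} → B a → B b → B (a ∗ b)
      ⇒∈ : ∀ {a b} → B a → B b → B (a ⇒ b)

  IsMax : (B P : Carrier → Set) → Carrier → Set
  IsMax B P m = (B m × P m) × (∀ b → B b → P b → b ≤ m)

  IsMin : (B P : Carrier → Set) → Carrier → Set
  IsMin B P m = (B m × P m) × (∀ b → B b → P b → m ≤ b)

  record RelComplete (B : Carrier → Set) (c : Carrier) : Set where
    field
      subalg : IsSubalgebra B
      e1-max : ∀ a → Σ Carrier (IsMax B (λ b → b ≤ c ⇒ a))
      e1-min : ∀ a → Σ Carrier (IsMin B (λ b → c ∗ a ≤ b))
      e2 : ∀ a → ((c ² ≤ a) × B a) ⇔ (a ≡ 𝟙)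

  record IsEBL (∀' ∃' : Carrier → Carrier) : Set where
    field
      ax1 : ∀' 𝟙 ≡ 𝟙
      ax2 : ∃' 𝟘 ≡ 𝟘
      ax3 : ∀ a → ∀' a ⇒ ∃' a ≡ 𝟙
      ax4 : ∀ a b → ∀' (a ⇒ ∀' b) ≡ ∃' a ⇒ ∀' b
      ax5 : ∀ a b → ∀' (∀' a ⇒ b) ≡ ∀' a ⇒ ∀' b
      ax6 : ∀ a → ∃' a ⇒ ∀' (∃' a) ≡ 𝟙
      ax7 : ∀ a b → ∀' (a ⊓ b) ≡ ∀' a ⊓ ∀' b
      ax8 : ∀ a b → ∃' (a ⊔ b) ≡ ∃' a ⊔ ∃' b
      ax9 : ∀ a b → ∃' (a ∗ ∃' b) ≡ ∃' a ∗ ∃' b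

  IsFocal : (∀' : Carrier → Carrier) → Carrier → Set
  IsFocal ∀' c = (∀' c ≡ 𝟙) × (∀ a → ∀' a ≡ 𝟙 → c ≤ a)

  IsCEBL : (∀' ∃' : Carrier → Carrier) → Carrier → Set
  IsCEBL ∀' ∃' c = IsEBL ∀' ∃' × IsFocal ∀' c

  Image : (Carrier → Carrier) → Carrier → Set
  Image f x = Σ Carrier (λ a → f a ≡ x)

  SameSet : (Carrier → Set) → (Carrier → Set) → Set
  SameSet P Q = ∀ x → P x ⇔ Q x

  ∀ᴮ : ∀ {B c} → RelComplete B c → Carrier → Carrier
  ∀ᴮ rc a = proj₁ (RelComplete.e1-max rc a)

  ∃ᴮ : ∀ {B c} → RelComplete B c → Carrier → Carrier
  ∃ᴮ rc a = proj₁ (RelComplete.e1-min rc a)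

-- Within B, ∀ a and ∃ a are the right and left adjoints of c ⇒ _ and c ∗ _, so each EBL axiom
-- follows by comparing lower (or upper) bounds in B and moving c across ⇒ by residuation. The
-- factor c is then cancelled by (e2): for x, y ∈ B, c² ∗ x ≤ y puts x ⇒ y ∈ B above c², whence
-- x ≤ y; in particular ∀ and ∃ fix B pointwise, so both have image B. Conversely, in a c-EBL-algebra
-- ∀ is idempotent and its image is the set of common fixed points of ∀ and ∃, which is closed under
-- the operations. As c is least with ∀ c = 1, an inequality c ≤ b ⇒ a with ∀ b = b becomes
-- 1 = ∀ (b ⇒ a) = b ⇒ ∀ a, which yields (e1) and (e2).
module Submission where

open import Defs
open import Data.Product using (_×_; _,_; proj₁; proj₂)
open import Relation.Binary.PropositionalEquality
open import Relation.Binary.Reasoning.Syntax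

⇔-refl : ∀ {P} → P ⇔ P
⇔-refl = (λ p → p) , (λ p → p)

⇔-sym : ∀ {P Q} → P ⇔ Q → Q ⇔ P
⇔-sym (f , g) = g , f

⇔-trans : ∀ {P Q R} → P ⇔ Q → Q ⇔ R → P ⇔ R
⇔-trans (f , g) (h , k) = (λ p → h (f p)) , (λ r → g (k r))

≡⇒⇔ : ∀ {P Q} → P ≡ Q → P ⇔ Q
≡⇒⇔ refl = ⇔-refl

×-cong : ∀ {P Q R S} → P ⇔ Q → R ⇔ S → (P × R) ⇔ (Q × S)
×-cong (f , g) (h , k) = (λ { (p , r) → f p , h r }) , (λ { (q , s) → g q , k s })

module ⇔-Reasoning where
  open begin-syntax _⇔_ (λ p → p) public
  open ↔-syntax _⇔_ _⇔_ ⇔-trans ⇔-sym public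
  open end-syntax _⇔_ ⇔-refl public

module BLProperties (A : BLAlgebra) where
  open BLAlgebra A
  open ⇔-Reasoning

  ≤-refl : ∀ {a} → a ≤ a
  ≤-refl {a} = trans (cong (a ⊓_) (sym (⊔-absorb a a))) (⊓-absorb a (a ⊓ a))

  ≤-antisym : ∀ {a b} → a ≤ b → b ≤ a → a ≡ b
  ≤-antisym {a} {b} p q = trans (sym p) (trans (⊓-comm a b) q)

  ≤-trans : ∀ {a b d} → a ≤ b → b ≤ d → a ≤ d
  ≤-trans {a} {b} {d} p q =
    trans (cong (_⊓ d) (sym p)) (trans (⊓-assoc a b d) (trans (cong (a ⊓_) q) p))

  ≡-by-lower-bounds : ∀ {P : Carrier → Set} {m n} → P m → P n →
                      (∀ {x} → P x → (x ≤ m) ⇔ (x ≤ n)) → m ≡ n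
  ≡-by-lower-bounds Pm Pn h = ≤-antisym (proj₁ (h Pm) ≤-refl) (proj₂ (h Pn) ≤-refl)

  ≡-by-upper-bounds : ∀ {P : Carrier → Set} {m n} → P m → P n →
                      (∀ {x} → P x → (m ≤ x) ⇔ (n ≤ x)) → m ≡ n
  ≡-by-upper-bounds Pm Pn h = ≤-antisym (proj₂ (h Pn) ≤-refl) (proj₁ (h Pm) ≤-refl)

  ⊓-lowerˡ : ∀ a b → a ⊓ b ≤ a
  ⊓-lowerˡ a b = trans (⊓-comm (a ⊓ b) a) (trans (sym (⊓-assoc a a b)) (cong (_⊓ b) ≤-refl))

  ⊓-lowerʳ : ∀ a b → a ⊓ b ≤ b
  ⊓-lowerʳ a b = subst (_≤ b) (⊓-comm b a) (⊓-lowerˡ b a)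

  ⊓-universal : ∀ x a b → (x ≤ a × x ≤ b) ⇔ (x ≤ a ⊓ b)
  ⊓-universal x a b =
    (λ { (p , q) → trans (sym (⊓-assoc x a b)) (trans (cong (_⊓ b) p) q) }) ,
    (λ r → ≤-trans r (⊓-lowerˡ a b) , ≤-trans r (⊓-lowerʳ a b))

  ⊔-upperˡ : ∀ a b → a ≤ a ⊔ b
  ⊔-upperˡ = ⊓-absorb

  ⊔-upperʳ : ∀ a b → b ≤ a ⊔ b
  ⊔-upperʳ a b = subst (b ≤_) (⊔-comm b a) (⊓-absorb b a)

  ≤⇒⊔≡ : ∀ {a b} → a ≤ b → a ⊔ b ≡ b
  ≤⇒⊔≡ {a} {b} p = trans (cong (_⊔ b) (sym p))
    (trans (⊔-comm (a ⊓ b) b) (trans (cong (b ⊔_) (⊓-comm a b)) (⊔-absorb b a)))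

  ⊔≡⇒≤ : ∀ {a b} → a ⊔ b ≡ b → a ≤ b
  ⊔≡⇒≤ {a} {b} p = trans (cong (a ⊓_) (sym p)) (⊓-absorb a b)

  ⊔-universal : ∀ x a b → (a ≤ x × b ≤ x) ⇔ (a ⊔ b ≤ x)
  ⊔-universal x a b =
    (λ { (p , q) → ⊔≡⇒≤ (trans (⊔-assoc a b x) (trans (cong (a ⊔_) (≤⇒⊔≡ q)) (≤⇒⊔≡ p))) }) ,
    (λ r → ≤-trans (⊔-upperˡ a b) r , ≤-trans (⊔-upperʳ a b) r)

  ∗-identityˡ : ∀ a → 𝟙 ∗ a ≡ a
  ∗-identityˡ a = trans (∗-comm 𝟙 a) (∗-identity a)

  𝟙≤a⇒a≡𝟙 : ∀ {a} → 𝟙 ≤ a → a ≡ 𝟙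
  𝟙≤a⇒a≡𝟙 {a} = ≤-antisym (𝟙-greatest a)

  a⇒b≡𝟙⇒a≤b : ∀ {a b} → a ⇒ b ≡ 𝟙 → a ≤ b
  a⇒b≡𝟙⇒a≤b {a} {b} p =
    subst (_≤ b) (∗-identityˡ a) (proj₂ (residuation 𝟙 a b) (subst (𝟙 ≤_) (sym p) ≤-refl))

  a≤b⇒a⇒b≡𝟙 : ∀ {a b} → a ≤ b → a ⇒ b ≡ 𝟙
  a≤b⇒a⇒b≡𝟙 {a} {b} p =
    𝟙≤a⇒a≡𝟙 (proj₁ (residuation 𝟙 a b) (subst (_≤ b) (sym (∗-identityˡ a)) p))

  ⇒-refl : ∀ a → a ⇒ a ≡ 𝟙
  ⇒-refl a = a≤b⇒a⇒b≡𝟙 ≤-refl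

  ∗-monoˡ : ∀ {a b} x → a ≤ b → a ∗ x ≤ b ∗ x
  ∗-monoˡ {a} {b} x p =
    proj₂ (residuation a x (b ∗ x)) (≤-trans p (proj₁ (residuation b x (b ∗ x)) ≤-refl))

  ∗-monoʳ : ∀ {a b} x → a ≤ b → x ∗ a ≤ x ∗ b
  ∗-monoʳ {a} {b} x p = subst₂ _≤_ (∗-comm a x) (∗-comm b x) (∗-monoˡ x p)

  ∗-decreasingʳ : ∀ a b → a ∗ b ≤ b
  ∗-decreasingʳ a b = subst (a ∗ b ≤_) (∗-identityˡ b) (∗-monoˡ b (𝟙-greatest a))

  ∗-decreasingˡ : ∀ a b → a ∗ b ≤ a
  ∗-decreasingˡ a b = subst (_≤ a) (∗-comm b a) (∗-decreasingʳ b a)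

  residuationʳ : ∀ a b d → (a ∗ b ≤ d) ⇔ (b ≤ a ⇒ d)
  residuationʳ a b d = ⇔-trans (≡⇒⇔ (cong (_≤ d) (∗-comm a b))) (residuation b a d)

  ⇒-exchange : ∀ x y z → (x ≤ y ⇒ z) ⇔ (y ≤ x ⇒ z)
  ⇒-exchange x y z = ⇔-trans (⇔-sym (residuation x y z)) (residuationʳ x y z)

  ⇒-curry : ∀ x y z w → (x ≤ y ⇒ (z ⇒ w)) ⇔ (x ≤ y ∗ z ⇒ w)
  ⇒-curry x y z w = begin
    x ≤ y ⇒ (z ⇒ w)  ↔⟨ residuation x y (z ⇒ w) ⟨
    x ∗ y ≤ z ⇒ w    ↔⟨ residuation (x ∗ y) z w ⟨
    x ∗ y ∗ z ≤ w    ↔⟨ ≡⇒⇔ (cong (_≤ w) (∗-assoc x y z)) ⟩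
    x ∗ (y ∗ z) ≤ w  ↔⟨ residuation x (y ∗ z) w ⟩
    x ≤ y ∗ z ⇒ w    ∎

  ⇒-⊓-universal : ∀ x c a b → (x ≤ c ⇒ a × x ≤ c ⇒ b) ⇔ (x ≤ c ⇒ (a ⊓ b))
  ⇒-⊓-universal x c a b = begin
    (x ≤ c ⇒ a × x ≤ c ⇒ b)  ↔⟨ ×-cong (residuation x c a) (residuation x c b) ⟨
    (x ∗ c ≤ a × x ∗ c ≤ b)  ↔⟨ ⊓-universal (x ∗ c) a b ⟩
    x ∗ c ≤ a ⊓ b            ↔⟨ residuation x c (a ⊓ b) ⟩
    x ≤ c ⇒ (a ⊓ b)          ∎

  ∗-⊔-universal : ∀ x c a b → (c ∗ a ≤ x × c ∗ b ≤ x) ⇔ (c ∗ (a ⊔ b) ≤ x)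
  ∗-⊔-universal x c a b = begin
    (c ∗ a ≤ x × c ∗ b ≤ x)  ↔⟨ ×-cong (residuationʳ c a x) (residuationʳ c b x) ⟩
    (a ≤ c ⇒ x × b ≤ c ⇒ x)  ↔⟨ ⊔-universal (c ⇒ x) a b ⟩
    a ⊔ b ≤ c ⇒ x            ↔⟨ residuationʳ c (a ⊔ b) x ⟨
    c ∗ (a ⊔ b) ≤ x          ∎

  image-of-retraction : ∀ {B : Carrier → Set} (f : Carrier → Carrier) →
                        (∀ a → B (f a)) → (∀ {b} → B b → f b ≡ b) → SameSet A (Image A f) B
  image-of-retraction f f∈ f-fixes x =
    (λ { (a , refl) → f∈ a }) , (λ x∈ → x , f-fixes x∈)

module RelativelyComplete (A : BLAlgebra) {B : BLAlgebra.Carrier A → Set} {c : BLAlgebra.Carrier A}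
                          (rc : RelComplete A B c) where
  open BLAlgebra A
  open BLProperties A
  open RelComplete rc
  open IsSubalgebra subalg
  open ⇔-Reasoning

  ∀ᶜ ∃ᶜ : Carrier → Carrier
  ∀ᶜ = ∀ᴮ A rc
  ∃ᶜ = ∃ᴮ A rc

  ∀ᶜ-∈ : ∀ a → B (∀ᶜ a)
  ∀ᶜ-∈ a = proj₁ (proj₁ (proj₂ (e1-max a)))

  ∃ᶜ-∈ : ∀ a → B (∃ᶜ a)
  ∃ᶜ-∈ a = proj₁ (proj₁ (proj₂ (e1-min a)))

  ∀ᶜ-adjoint : ∀ {x} a → B x → (x ≤ c ⇒ a) ⇔ (x ≤ ∀ᶜ a)
  ∀ᶜ-adjoint {x} a x∈ =
    proj₂ (proj₂ (e1-max a)) x x∈ , (λ x≤ → ≤-trans x≤ (proj₂ (proj₁ (proj₂ (e1-max a)))))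

  ∃ᶜ-adjoint : ∀ {x} a → B x → (c ∗ a ≤ x) ⇔ (∃ᶜ a ≤ x)
  ∃ᶜ-adjoint {x} a x∈ =
    proj₂ (proj₂ (e1-min a)) x x∈ , ≤-trans (proj₂ (proj₁ (proj₂ (e1-min a))))

  c∗∀ᶜ≤ : ∀ a → c ∗ ∀ᶜ a ≤ a
  c∗∀ᶜ≤ a = proj₂ (residuationʳ c (∀ᶜ a) a) (proj₂ (∀ᶜ-adjoint a (∀ᶜ-∈ a)) ≤-refl)

  c∗≤∃ᶜ : ∀ a → c ∗ a ≤ ∃ᶜ a
  c∗≤∃ᶜ a = proj₂ (∃ᶜ-adjoint a (∃ᶜ-∈ a)) ≤-refl

  -- (e2) is used only here: the hypothesis says c² ≤ x ⇒ y, and x ⇒ y ∈ B.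
  ≤-cancel-c² : ∀ {x y} → B x → B y → c ² ∗ x ≤ y → x ≤ y
  ≤-cancel-c² {x} {y} x∈ y∈ c²x≤y =
    a⇒b≡𝟙⇒a≤b (proj₁ (e2 (x ⇒ y)) (proj₁ (residuation (c ²) x y) c²x≤y , ⇒∈ x∈ y∈))

  ≤-cancel-c : ∀ {x y} → B x → B y → c ∗ x ≤ y → x ≤ y
  ≤-cancel-c {x} x∈ y∈ cx≤y = ≤-cancel-c² x∈ y∈ (≤-trans (∗-monoˡ x (∗-decreasingˡ c c)) cx≤y)

  ∀ᶜ-fixes : ∀ {b} → B b → ∀ᶜ b ≡ b
  ∀ᶜ-fixes {b} b∈ = ≡-by-lower-bounds (∀ᶜ-∈ b) b∈ λ {x} x∈ → begin
    x ≤ ∀ᶜ b   ↔⟨ ∀ᶜ-adjoint b x∈ ⟨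
    x ≤ c ⇒ b  ↔⟨ (λ x≤ → ≤-cancel-c x∈ b∈ (proj₂ (residuationʳ c x b) x≤)) ,
                  (λ x≤b → ≤-trans x≤b (proj₁ (residuationʳ c b b) (∗-decreasingʳ c b))) ⟩
    x ≤ b      ∎

  ∃ᶜ-fixes : ∀ {b} → B b → ∃ᶜ b ≡ b
  ∃ᶜ-fixes {b} b∈ = ≡-by-upper-bounds (∃ᶜ-∈ b) b∈ λ {x} x∈ → begin
    ∃ᶜ b ≤ x   ↔⟨ ∃ᶜ-adjoint b x∈ ⟨
    c ∗ b ≤ x  ↔⟨ ≤-cancel-c b∈ x∈ , ≤-trans (∗-decreasingʳ c b) ⟩
    b ≤ x      ∎

  ∀ᶜ≤∃ᶜ : ∀ a → ∀ᶜ a ≤ ∃ᶜ a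
  ∀ᶜ≤∃ᶜ a = ≤-cancel-c² (∀ᶜ-∈ a) (∃ᶜ-∈ a) c²∗∀ᶜ≤∃ᶜ
    where
    c²∗∀ᶜ≤∃ᶜ : c ² ∗ ∀ᶜ a ≤ ∃ᶜ a
    c²∗∀ᶜ≤∃ᶜ = ≤-trans (subst (_≤ c ∗ a) (sym (∗-assoc c c (∀ᶜ a))) (∗-monoʳ c (c∗∀ᶜ≤ a)))
                       (c∗≤∃ᶜ a)

  ∀ᶜ-⇒ʳ : ∀ a {b} → B b → ∀ᶜ (a ⇒ b) ≡ ∃ᶜ a ⇒ b
  ∀ᶜ-⇒ʳ a {b} b∈ = ≡-by-lower-bounds (∀ᶜ-∈ (a ⇒ b)) (⇒∈ (∃ᶜ-∈ a) b∈) λ {x} x∈ → begin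
    x ≤ ∀ᶜ (a ⇒ b)   ↔⟨ ∀ᶜ-adjoint (a ⇒ b) x∈ ⟨
    x ≤ c ⇒ (a ⇒ b)  ↔⟨ ⇒-curry x c a b ⟩
    x ≤ c ∗ a ⇒ b    ↔⟨ ⇒-exchange x (c ∗ a) b ⟩
    c ∗ a ≤ x ⇒ b    ↔⟨ ∃ᶜ-adjoint a (⇒∈ x∈ b∈) ⟩
    ∃ᶜ a ≤ x ⇒ b     ↔⟨ ⇒-exchange (∃ᶜ a) x b ⟩
    x ≤ ∃ᶜ a ⇒ b     ∎

  ∀ᶜ-⇒ˡ : ∀ a {b} → B b → ∀ᶜ (b ⇒ a) ≡ b ⇒ ∀ᶜ a
  ∀ᶜ-⇒ˡ a {b} b∈ = ≡-by-lower-bounds (∀ᶜ-∈ (b ⇒ a)) (⇒∈ b∈ (∀ᶜ-∈ a)) λ {x} x∈ → begin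
    x ≤ ∀ᶜ (b ⇒ a)   ↔⟨ ∀ᶜ-adjoint (b ⇒ a) x∈ ⟨
    x ≤ c ⇒ (b ⇒ a)  ↔⟨ ⇒-curry x c b a ⟩
    x ≤ c ∗ b ⇒ a    ↔⟨ ≡⇒⇔ (cong (λ y → x ≤ y ⇒ a) (∗-comm c b)) ⟩
    x ≤ b ∗ c ⇒ a    ↔⟨ ⇒-curry x b c a ⟨
    x ≤ b ⇒ (c ⇒ a)  ↔⟨ residuation x b (c ⇒ a) ⟨
    x ∗ b ≤ c ⇒ a    ↔⟨ ∀ᶜ-adjoint a (∗∈ x∈ b∈) ⟩
    x ∗ b ≤ ∀ᶜ a     ↔⟨ residuation x b (∀ᶜ a) ⟩
    x ≤ b ⇒ ∀ᶜ a     ∎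

  ∃ᶜ-∗ʳ : ∀ a {b} → B b → ∃ᶜ (a ∗ b) ≡ ∃ᶜ a ∗ b
  ∃ᶜ-∗ʳ a {b} b∈ = ≡-by-upper-bounds (∃ᶜ-∈ (a ∗ b)) (∗∈ (∃ᶜ-∈ a) b∈) λ {x} x∈ → begin
    ∃ᶜ (a ∗ b) ≤ x   ↔⟨ ∃ᶜ-adjoint (a ∗ b) x∈ ⟨
    c ∗ (a ∗ b) ≤ x  ↔⟨ ≡⇒⇔ (cong (_≤ x) (∗-assoc c a b)) ⟨
    c ∗ a ∗ b ≤ x    ↔⟨ residuation (c ∗ a) b x ⟩
    c ∗ a ≤ b ⇒ x    ↔⟨ ∃ᶜ-adjoint a (⇒∈ b∈ x∈) ⟩
    ∃ᶜ a ≤ b ⇒ x     ↔⟨ residuation (∃ᶜ a) b x ⟨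
    ∃ᶜ a ∗ b ≤ x     ∎

  ∀ᶜ-⊓ : ∀ a b → ∀ᶜ (a ⊓ b) ≡ ∀ᶜ a ⊓ ∀ᶜ b
  ∀ᶜ-⊓ a b = ≡-by-lower-bounds (∀ᶜ-∈ (a ⊓ b)) (⊓∈ (∀ᶜ-∈ a) (∀ᶜ-∈ b)) λ {x} x∈ → begin
    x ≤ ∀ᶜ (a ⊓ b)           ↔⟨ ∀ᶜ-adjoint (a ⊓ b) x∈ ⟨
    x ≤ c ⇒ (a ⊓ b)          ↔⟨ ⇒-⊓-universal x c a b ⟨
    (x ≤ c ⇒ a × x ≤ c ⇒ b)  ↔⟨ ×-cong (∀ᶜ-adjoint a x∈) (∀ᶜ-adjoint b x∈) ⟩
    (x ≤ ∀ᶜ a × x ≤ ∀ᶜ b)    ↔⟨ ⊓-universal x (∀ᶜ a) (∀ᶜ b) ⟩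
    x ≤ ∀ᶜ a ⊓ ∀ᶜ b          ∎

  ∃ᶜ-⊔ : ∀ a b → ∃ᶜ (a ⊔ b) ≡ ∃ᶜ a ⊔ ∃ᶜ b
  ∃ᶜ-⊔ a b = ≡-by-upper-bounds (∃ᶜ-∈ (a ⊔ b)) (⊔∈ (∃ᶜ-∈ a) (∃ᶜ-∈ b)) λ {x} x∈ → begin
    ∃ᶜ (a ⊔ b) ≤ x           ↔⟨ ∃ᶜ-adjoint (a ⊔ b) x∈ ⟨
    c ∗ (a ⊔ b) ≤ x          ↔⟨ ∗-⊔-universal x c a b ⟨
    (c ∗ a ≤ x × c ∗ b ≤ x)  ↔⟨ ×-cong (∃ᶜ-adjoint a x∈) (∃ᶜ-adjoint b x∈) ⟩
    (∃ᶜ a ≤ x × ∃ᶜ b ≤ x)    ↔⟨ ⊔-universal x (∃ᶜ a) (∃ᶜ b) ⟩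
    ∃ᶜ a ⊔ ∃ᶜ b ≤ x          ∎

  isEBL : IsEBL A ∀ᶜ ∃ᶜ
  isEBL = record
    { ax1 = ∀ᶜ-fixes 𝟙∈
    ; ax2 = ∃ᶜ-fixes 𝟘∈
    ; ax3 = λ a → a≤b⇒a⇒b≡𝟙 (∀ᶜ≤∃ᶜ a)
    ; ax4 = λ a b → ∀ᶜ-⇒ʳ a (∀ᶜ-∈ b)
    ; ax5 = λ a b → ∀ᶜ-⇒ˡ b (∀ᶜ-∈ a)
    ; ax6 = λ a → trans (cong (∃ᶜ a ⇒_) (∀ᶜ-fixes (∃ᶜ-∈ a))) (⇒-refl (∃ᶜ a))
    ; ax7 = ∀ᶜ-⊓
    ; ax8 = ∃ᶜ-⊔
    ; ax9 = λ a b → ∃ᶜ-∗ʳ a (∃ᶜ-∈ b)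
    }

  isFocal : IsFocal A ∀ᶜ c
  isFocal = 𝟙≤a⇒a≡𝟙 (proj₁ (∀ᶜ-adjoint c 𝟙∈) (subst (𝟙 ≤_) (sym (⇒-refl c)) ≤-refl)) ,
            λ a ∀ᶜa≡𝟙 → a⇒b≡𝟙⇒a≤b (𝟙≤a⇒a≡𝟙
              (proj₂ (∀ᶜ-adjoint a 𝟙∈) (subst (𝟙 ≤_) (sym ∀ᶜa≡𝟙) ≤-refl)))

  image-∀ᶜ : SameSet A (Image A ∀ᶜ) B
  image-∀ᶜ = image-of-retraction ∀ᶜ ∀ᶜ-∈ ∀ᶜ-fixes

  image-∃ᶜ : SameSet A (Image A ∃ᶜ) B
  image-∃ᶜ = image-of-retraction ∃ᶜ ∃ᶜ-∈ ∃ᶜ-fixes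

module FocalEBL (A : BLAlgebra) {∀' ∃' : BLAlgebra.Carrier A → BLAlgebra.Carrier A}
                {c : BLAlgebra.Carrier A} (cebl : IsCEBL A ∀' ∃' c) where
  open BLAlgebra A
  open BLProperties A
  open IsEBL (proj₁ cebl)

  ∀'c≡𝟙 : ∀' c ≡ 𝟙
  ∀'c≡𝟙 = proj₁ (proj₂ cebl)

  c-least : ∀ a → ∀' a ≡ 𝟙 → c ≤ a
  c-least = proj₂ (proj₂ cebl)

  ∀'-mono : ∀ {a b} → a ≤ b → ∀' a ≤ ∀' b
  ∀'-mono {a} {b} a≤b = trans (sym (ax7 a b)) (cong ∀' a≤b)

  ∀'≤∃' : ∀ a → ∀' a ≤ ∃' a
  ∀'≤∃' a = a⇒b≡𝟙⇒a≤b (ax3 a)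

  c≤a⇒∀'a≡𝟙 : ∀ {a} → c ≤ a → ∀' a ≡ 𝟙
  c≤a⇒∀'a≡𝟙 c≤a = 𝟙≤a⇒a≡𝟙 (subst (_≤ _) ∀'c≡𝟙 (∀'-mono c≤a))

  ∃'∀'≤∀' : ∀ a → ∃' (∀' a) ≤ ∀' a
  ∃'∀'≤∀' a = a⇒b≡𝟙⇒a≤b (trans (sym (ax4 (∀' a) a)) (trans (cong ∀' (⇒-refl (∀' a))) ax1))

  ∀'-idem : ∀ a → ∀' (∀' a) ≡ ∀' a
  ∀'-idem a = ≤-antisym (≤-trans (∀'≤∃' (∀' a)) (∃'∀'≤∀' a)) ∀'a≤∀'∀'a
    where
    ∀'a≤∀'∀'a : ∀' a ≤ ∀' (∀' a)
    ∀'a≤∀'∀'a = a⇒b≡𝟙⇒a≤b (trans (sym (ax5 a (∀' a))) (trans (cong ∀' (⇒-refl (∀' a))) ax1))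

  ∀'∃' : ∀ a → ∀' (∃' a) ≡ ∃' a
  ∀'∃' a = ≤-antisym (≤-trans (∀'≤∃' (∃' a)) ∃'∃'a≤∃'a) (a⇒b≡𝟙⇒a≤b (ax6 a))
    where
    ∃'∃'a≤∃'a : ∃' (∃' a) ≤ ∃' a
    ∃'∃'a≤∃'a = subst (_≤ ∃' a) (trans (sym (ax9 𝟙 a)) (cong ∃' (∗-identityˡ (∃' a))))
                      (∗-decreasingʳ (∃' 𝟙) (∃' a))

  ∀'𝟘 : ∀' 𝟘 ≡ 𝟘
  ∀'𝟘 = ≤-antisym (subst (∀' 𝟘 ≤_) ax2 (∀'≤∃' 𝟘)) (𝟘-least (∀' 𝟘))

  image⇒fixed : ∀ {x} → Image A ∀' x → ∀' x ≡ x
  image⇒fixed (a , refl) = ∀'-idem a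

  ∃'-fixes : ∀ {x} → ∀' x ≡ x → ∃' x ≡ x
  ∃'-fixes {x} fx = ≤-antisym (subst₂ (λ u v → ∃' u ≤ v) fx fx (∃'∀'≤∀' x))
                              (subst (_≤ ∃' x) fx (∀'≤∃' x))

  ∃'-fixed⇒∀'-fixed : ∀ {x} → ∃' x ≡ x → ∀' x ≡ x
  ∃'-fixed⇒∀'-fixed {x} ex = trans (cong ∀' (sym ex)) (trans (∀'∃' x) ex)

  ∀'-⇒ˡ : ∀ a {b} → ∀' b ≡ b → ∀' (b ⇒ a) ≡ b ⇒ ∀' a
  ∀'-⇒ˡ a {b} fb = subst (λ z → ∀' (z ⇒ a) ≡ z ⇒ ∀' a) fb (ax5 b a)

  ∀'-⇒ʳ : ∀ a {b} → ∀' b ≡ b → ∀' (a ⇒ b) ≡ ∃' a ⇒ b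
  ∀'-⇒ʳ a {b} fb = subst (λ z → ∀' (a ⇒ z) ≡ ∃' a ⇒ z) fb (ax4 a b)

  ∃'-∗ʳ : ∀ a {b} → ∃' b ≡ b → ∃' (a ∗ b) ≡ ∃' a ∗ b
  ∃'-∗ʳ a {b} eb = subst (λ z → ∃' (a ∗ z) ≡ ∃' a ∗ z) eb (ax9 a b)

  image-subalgebra : IsSubalgebra A (Image A ∀')
  image-subalgebra = record
    { 𝟘∈ = 𝟘 , ∀'𝟘
    ; 𝟙∈ = 𝟙 , ax1
    ; ⊓∈ = λ {x} {y} x∈ y∈ →
        x ⊓ y , trans (ax7 x y) (cong₂ _⊓_ (image⇒fixed x∈) (image⇒fixed y∈))
    ; ⊔∈ = λ {x} {y} x∈ y∈ → x ⊔ y , ∃'-fixed⇒∀'-fixed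
        (trans (ax8 x y) (cong₂ _⊔_ (∃'-fixes (image⇒fixed x∈)) (∃'-fixes (image⇒fixed y∈))))
    ; ∗∈ = λ {x} {y} x∈ y∈ → x ∗ y , ∃'-fixed⇒∀'-fixed
        (trans (∃'-∗ʳ x (∃'-fixes (image⇒fixed y∈))) (cong (_∗ y) (∃'-fixes (image⇒fixed x∈))))
    ; ⇒∈ = λ {x} {y} x∈ y∈ →
        x ⇒ y , trans (∀'-⇒ˡ y (image⇒fixed x∈)) (cong (x ⇒_) (image⇒fixed y∈))
    }

  c∗∀'≤ : ∀ a → c ∗ ∀' a ≤ a
  c∗∀'≤ a = proj₂ (residuation c (∀' a) a) (c-least (∀' a ⇒ a) (trans (ax5 a a) (⇒-refl (∀' a))))

  c∗≤∃' : ∀ a → c ∗ a ≤ ∃' a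
  c∗≤∃' a = proj₂ (residuation c a (∃' a))
                  (c-least (a ⇒ ∃' a) (trans (∀'-⇒ʳ a (∀'∃' a)) (⇒-refl (∃' a))))

  ≤∀'-of-fixed : ∀ {a b} → ∀' b ≡ b → b ≤ c ⇒ a → b ≤ ∀' a
  ≤∀'-of-fixed {a} {b} fb b≤ =
    a⇒b≡𝟙⇒a≤b (trans (sym (∀'-⇒ˡ a fb)) (c≤a⇒∀'a≡𝟙 (proj₁ (⇒-exchange b c a) b≤)))

  ∃'≤-of-fixed : ∀ {a b} → ∀' b ≡ b → c ∗ a ≤ b → ∃' a ≤ b
  ∃'≤-of-fixed {a} {b} fb ca≤b =
    a⇒b≡𝟙⇒a≤b (trans (sym (∀'-⇒ʳ a fb)) (c≤a⇒∀'a≡𝟙 (proj₁ (residuation c a b) ca≤b)))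

  fixed-above-c²≡𝟙 : ∀ {a} → ∀' a ≡ a → c ² ≤ a → a ≡ 𝟙
  fixed-above-c²≡𝟙 fa c²≤a =
    𝟙≤a⇒a≡𝟙 (≤-trans (subst (_≤ ∃' c) ∀'c≡𝟙 (∀'≤∃' c)) (∃'≤-of-fixed fa c²≤a))

  relativelyComplete : RelComplete A (Image A ∀') c
  relativelyComplete = record
    { subalg = image-subalgebra
    ; e1-max = λ a → ∀' a , ((a , refl) , proj₁ (residuationʳ c (∀' a) a) (c∗∀'≤ a)) ,
                     λ _ b∈ → ≤∀'-of-fixed (image⇒fixed b∈)
    ; e1-min = λ a → ∃' a , ((∃' a , ∀'∃' a) , c∗≤∃' a) ,
                     λ _ b∈ → ∃'≤-of-fixed (image⇒fixed b∈)
    ; e2 = λ _ → (λ { (c²≤a , a∈) → fixed-above-c²≡𝟙 (image⇒fixed a∈) c²≤a }) ,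
                 (λ { refl → 𝟙-greatest (c ²) , 𝟙 , ax1 })
    }

theorem8 : (A : BLAlgebra) → let open BLAlgebra A in
    (∀ (B : Carrier → Set) (c : Carrier) (rc : RelComplete A B c) →
        IsCEBL A (∀ᴮ A rc) (∃ᴮ A rc) c
      × SameSet A (Image A (∀ᴮ A rc)) B
      × SameSet A (Image A (∃ᴮ A rc)) B)
    × (∀ (∀' ∃' : Carrier → Carrier) (c : Carrier) →
        IsCEBL A ∀' ∃' c → RelComplete A (Image A ∀') c)
theorem8 A =
  (λ B c rc → let open RelativelyComplete A rc in (isEBL , isFocal) , image-∀ᶜ , image-∃ᶜ) ,
  (λ _ _ _ cebl → FocalEBL.relativelyComplete A cebl)
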